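{- Let $s_1,s_2$ be two distinct first-order terms. Then there is at most one substitution of the form $\{X/u\}$, with $X$ a variable and $u$ a term that is not a variable, which unifies $s_1$ and $s_2$ (i.e. satisfies $s_1\{X/u\}=s_2\{X/u\}$). -}

module Defs where

open import Data.Nat using (ℕ; _≟_)
open import Data.Vec using (Vec; []; _∷_)
open import Data.Empty using (⊥)
open import Data.Unit using (⊤)
open import Relation.Nullary using (yes; no)

record Signature : Set₁ where
  field
    Sym   : Set
    arity : Sym → ℕ
open Signature public

module _ (Σ : Signature) where
  data Term : Set where
    var : ℕ → Term
    fun : (f : Sym Σ) → Vec Term (arity Σ f) → Term

module _ {Σ : Signature} where
  mutual
    _⟨_/_⟩ : Term Σ → ℕ → Term Σ → Term Σ
    var Y    ⟨ X / u ⟩ with Y ≟ X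
    ... | yes _ = u
    ... | no  _ = var Y
    fun f ts ⟨ X / u ⟩ = fun f (substs ts X u)

    substs : ∀ {n} → Vec (Term Σ) n → ℕ → Term Σ → Vec (Term Σ) n
    substs []       X u = []
    substs (t ∷ ts) X u = (t ⟨ X / u ⟩) ∷ substs ts X u

  NonVar : Term Σ → Set
  NonVar (var _)   = ⊥
  NonVar (fun _ _) = ⊤

  Unifies : ℕ → Term Σ → Term Σ → Term Σ → Set
  Unifies X u s₁ s₂ = (s₁ ⟨ X / u ⟩) ≡ (s₂ ⟨ X / u ⟩)
    where open import Relation.Binary.PropositionalEquality using (_≡_)

module Submission where

-- Call a pair (var a, fun g ts) or (fun g ts, var a) a
-- clash.  A substitution {X/u} with u not a variable identifies s₁ and s₂
-- only if s₁ and s₂ agree everywhere except at positions where they clash: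
-- it cannot identify two distinct variables, nor two terms with different
-- head symbols.  Hence, if s₁ ≢ s₂, the unifier exhibits a clash at some
-- common position of s₁ and s₂ (the "disagreement"), and this clash is a
-- property of s₁, s₂ alone, not of the unifier.  Every unifier {X/u} of
-- s₁, s₂ must identify the two sides of that clash, and by the occurs
-- check this forces X = a and u = fun g ts.  So both unifiers of the
-- theorem are read off from the same clash and therefore coincide.

open import Defs
open import Data.Nat using (ℕ; suc; _+_; _≤_; _≟_)
open import Data.Nat.Properties using (≤-refl; ≤-trans; m≤m+n; m≤n+m; n≤1+n; 1+n≰n)
open import Data.Product using (_×_; _,_; ∃₂; proj₁; proj₂)
open import Data.Sum using (_⊎_; inj₁; inj₂)
open import Data.Vec using (Vec; []; _∷_)
open import Data.Vec.Properties using (∷-injectiveˡ; ∷-injectiveʳ)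
open import Data.Empty using (⊥-elim)
open import Relation.Nullary using (yes; no)
open import Relation.Binary.PropositionalEquality
  using (_≡_; _≢_; refl; sym; trans; cong; cong₂; subst)

module Unification {Sig : Signature} where

  private
    T : Set
    T = Term Sig

  fun-symbol-injective : ∀ {f g as bs} → fun {Sig} f as ≡ fun g bs → f ≡ g
  fun-symbol-injective refl = refl

  fun-args-injective : ∀ {f as bs} → fun {Sig} f as ≡ fun f bs → as ≡ bs
  fun-args-injective refl = refl

  var-injective : ∀ {a b} → var {Sig} a ≡ var b → a ≡ b
  var-injective refl = refl

  mutual
    size : T → ℕ
    size (var _)    = 1
    size (fun f ts) = suc (sizes ts)

    sizes : ∀ {n} → Vec T n → ℕ
    sizes []       = 0
    sizes (t ∷ ts) = size t + sizes ts

  module _ (X : ℕ) (u : T) where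

    mutual
      unchanged-or-contains : ∀ t → (t ⟨ X / u ⟩ ≡ t) ⊎ (size u ≤ size (t ⟨ X / u ⟩))
      unchanged-or-contains (var a) with a ≟ X
      ... | yes _ = inj₂ ≤-refl
      ... | no  _ = inj₁ refl
      unchanged-or-contains (fun f ts) with unchanged-or-contains-args ts
      ... | inj₁ same  = inj₁ (cong (fun f) same)
      ... | inj₂ large = inj₂ (≤-trans large (n≤1+n _))

      unchanged-or-contains-args : ∀ {n} (ts : Vec T n) →
        (substs ts X u ≡ ts) ⊎ (size u ≤ sizes (substs ts X u))
      unchanged-or-contains-args [] = inj₁ refl
      unchanged-or-contains-args (t ∷ ts)
        with unchanged-or-contains t | unchanged-or-contains-args ts
      ... | inj₂ large | _          = inj₂ (≤-trans large (m≤m+n _ _))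
      ... | inj₁ _     | inj₂ large = inj₂ (≤-trans large (m≤n+m _ _))
      ... | inj₁ same  | inj₁ same′ = inj₁ (cong₂ _∷_ same same′)

    -- Occurs check: if {X/u} identifies a variable with a non-variable term
    -- fun g ts, the variable is X and u is that term (X cannot occur in ts,
    -- since u = fun g (ts{X/u}) would then be a proper subterm of itself).
    occurs-check : ∀ a g ts → var a ⟨ X / u ⟩ ≡ fun g ts ⟨ X / u ⟩ →
                   (a ≡ X) × (u ≡ fun g ts)
    occurs-check a g ts e with a ≟ X
    occurs-check a g ts () | no _
    ... | yes a≡X with unchanged-or-contains-args ts
    ...   | inj₁ same  = a≡X , trans e (cong (fun g) same)
    ...   | inj₂ large = ⊥-elim (1+n≰n (subst (_≤ sizes (substs ts X u)) (cong size e) large))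

    non-variable : ∀ {b} → NonVar u → u ≢ var b
    non-variable {b} nonvar e = subst NonVar e nonvar

    distinct-variables-stay-distinct : NonVar u → ∀ {a b} → a ≢ b →
                                       var a ⟨ X / u ⟩ ≢ var b ⟨ X / u ⟩
    distinct-variables-stay-distinct nonvar {a} {b} a≢b e with a ≟ X | b ≟ X
    ... | yes a≡X | yes b≡X = a≢b (trans a≡X (sym b≡X))
    ... | no  _   | no  _   = a≢b (var-injective e)
    distinct-variables-stay-distinct nonvar _ e | yes _ | no _ = non-variable nonvar e
    distinct-variables-stay-distinct nonvar _ e | no _ | yes _ = non-variable nonvar (sym e)

  data Clash : T → T → Set where
    var-fun : ∀ {a g ts} → Clash (var a) (fun g ts)
    fun-var : ∀ {a g ts} → Clash (fun g ts) (var a)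

  resolvent : ∀ {t t′} → Clash t t′ → ℕ × T
  resolvent (var-fun {a} {g} {ts}) = a , fun g ts
  resolvent (fun-var {a} {g} {ts}) = a , fun g ts

  clash-determines-unifier : ∀ {t t′} (c : Clash t t′) (X : ℕ) (u : T) →
    t ⟨ X / u ⟩ ≡ t′ ⟨ X / u ⟩ → (X , u) ≡ resolvent c
  clash-determines-unifier (var-fun {a} {g} {ts}) X u e with occurs-check X u a g ts e
  ... | refl , refl = refl
  clash-determines-unifier (fun-var {a} {g} {ts}) X u e with occurs-check X u a g ts (sym e)
  ... | refl , refl = refl

  -- Position t t′ s s′: t and t′ occur at the same position of s and s′
  -- respectively, all symbols on the path from the root being shared.
  mutual
    data Position (t t′ : T) : T → T → Set where
      here  : Position t t′ t t′
      under : ∀ {f} {ss ss′ : Vec T (arity Sig f)} → Positions t t′ ss ss′ →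
              Position t t′ (fun f ss) (fun f ss′)

    data Positions (t t′ : T) : ∀ {n} → Vec T n → Vec T n → Set where
      in-head : ∀ {n s s′} {ss ss′ : Vec T n} → Position t t′ s s′ →
                Positions t t′ (s ∷ ss) (s′ ∷ ss′)
      in-tail : ∀ {n s s′} {ss ss′ : Vec T n} → Positions t t′ ss ss′ →
                Positions t t′ (s ∷ ss) (s′ ∷ ss′)

  mutual
    unifies-at : ∀ {X u t t′ s s′} → Position t t′ s s′ →
                 s ⟨ X / u ⟩ ≡ s′ ⟨ X / u ⟩ → t ⟨ X / u ⟩ ≡ t′ ⟨ X / u ⟩
    unifies-at here      e = e
    unifies-at (under p) e = unifies-at-args p (fun-args-injective e)

    unifies-at-args : ∀ {X u t t′ n} {ss ss′ : Vec T n} → Positions t t′ ss ss′ →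
                      substs ss X u ≡ substs ss′ X u → t ⟨ X / u ⟩ ≡ t′ ⟨ X / u ⟩
    unifies-at-args (in-head p) e = unifies-at p (∷-injectiveˡ e)
    unifies-at-args (in-tail p) e = unifies-at-args p (∷-injectiveʳ e)

  ClashAt : (T → T → Set) → Set
  ClashAt R = ∃₂ λ t t′ → Clash t t′ × R t t′

  relocate : ∀ {R R′ : T → T → Set} → (∀ {t t′} → R t t′ → R′ t t′) → ClashAt R → ClashAt R′
  relocate move (t , t′ , c , r) = t , t′ , c , move r

  Disagreement : T → T → Set
  Disagreement s s′ = ClashAt (λ t t′ → Position t t′ s s′)

  Disagreements : ∀ {n} → Vec T n → Vec T n → Set
  Disagreements ss ss′ = ClashAt (λ t t′ → Positions t t′ ss ss′)

  module _ (X : ℕ) (u : T) (nonvar : NonVar u) where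
    mutual
      equal-or-disagree : ∀ s s′ → s ⟨ X / u ⟩ ≡ s′ ⟨ X / u ⟩ → s ≡ s′ ⊎ Disagreement s s′
      equal-or-disagree (var a) (var b) e with a ≟ b
      ... | yes refl = inj₁ refl
      ... | no  a≢b  = ⊥-elim (distinct-variables-stay-distinct X u nonvar a≢b e)
      equal-or-disagree (var a)    (fun g ts) _ = inj₂ (_ , _ , var-fun , here)
      equal-or-disagree (fun f ts) (var a)    _ = inj₂ (_ , _ , fun-var , here)
      equal-or-disagree (fun f ts) (fun g ts′) e with fun-symbol-injective e
      ... | refl with equal-or-disagree-args ts ts′ (fun-args-injective e)
      ...   | inj₁ same = inj₁ (cong (fun f) same)
      ...   | inj₂ d    = inj₂ (relocate under d)

      equal-or-disagree-args : ∀ {n} (ss ss′ : Vec T n) → substs ss X u ≡ substs ss′ X u →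
                               ss ≡ ss′ ⊎ Disagreements ss ss′
      equal-or-disagree-args [] [] _ = inj₁ refl
      equal-or-disagree-args (s ∷ ss) (s′ ∷ ss′) e
        with equal-or-disagree s s′ (∷-injectiveˡ e)
      ... | inj₂ d    = inj₂ (relocate in-head d)
      ... | inj₁ refl with equal-or-disagree-args ss ss′ (∷-injectiveʳ e)
      ...   | inj₁ refl = inj₁ refl
      ...   | inj₂ d    = inj₂ (relocate in-tail d)

  disagreement : ∀ {s s′} X u → NonVar u → s ≢ s′ → s ⟨ X / u ⟩ ≡ s′ ⟨ X / u ⟩ →
                 Disagreement s s′
  disagreement {s} {s′} X u nonvar s≢s′ e with equal-or-disagree X u nonvar s s′ e
  ... | inj₁ s≡s′ = ⊥-elim (s≢s′ s≡s′)
  ... | inj₂ d    = d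

  unifier-is-resolvent : ∀ {s s′} ((_ , _ , c , _) : Disagreement s s′) X u →
                         Unifies X u s s′ → (X , u) ≡ resolvent c
  unifier-is-resolvent (_ , _ , c , p) X u e = clash-determines-unifier c X u (unifies-at p e)

open Unification

lemma2 : (Σ : Signature) (s₁ s₂ : Term Σ) → s₁ ≢ s₂ →
    (X Y : ℕ) (u v : Term Σ) → NonVar u → NonVar v →
    Unifies X u s₁ s₂ → Unifies Y v s₁ s₂ →
    (X ≡ Y) × (u ≡ v)
lemma2 Σ s₁ s₂ s₁≢s₂ X Y u v nonvar-u _ unif-u unif-v = cong proj₁ same , cong proj₂ same
  where
    d : Disagreement s₁ s₂
    d = disagreement X u nonvar-u s₁≢s₂ unif-u
    same : (X , u) ≡ (Y , v)
    same = trans (unifier-is-resolvent d X u unif-u) (sym (unifier-is-resolvent d Y v unif-v))
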